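{- Let $s,t$ be positive integers and let $\pi$ be a linear extension of $SAW_{s,t}$. Then the children of $\pi$ (as defined below) have labels exactly $t-1, t, t+1, \dots, \mathrm{label}(\pi)+t-1$, each occurring for exactly one child.
   Context: Write each $x \in [st]$ uniquely as $x=(j-1)t+r$ with $1\le j\le s$, $1\le r\le t$. The poset $EN_{s,t}$ is $[st]$ with $(j-1)t+r \preceq (j'-1)t+r'$ iff $j'\le j$ and $r\le r'$. The sawblade poset $SAW_{s,t}$ is the poset on $[st]$ whose order is generated by the relations of $EN_{s,t}$ together with $(j+1)t \preceq (j-1)t+2$ for all $1\le j\le s-1$. A linear extension of a poset $([n],\preceq)$ is a permutation $\pi$ of $[n]$ in one-line notation such that whenever $a\preceq b$, $a\neq b$, $a$ appears before $b$. The label of a linear extension $\pi$ of $SAW_{s,t}$, written $\mathrm{label}(\pi)$, is the number $j$ such that the entry $1$ is in position $st-j$ of $\pi$ (for the empty linear extension, with $s=0$, the label is $0$). A child of $\pi$ is a linear extension $\pi'$ of $SAW_{s+1,t}$ such that deleting the entries $1,\dots,t$ from $\pi'$ and subtracting $t$ from every remaining entry yields $\pi$. -}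

module Defs where

open import Data.Nat using (ℕ; zero; suc; _+_; _*_; _∸_; _≤_; _<_; _<?_; _≟_)
open import Data.List using (List; []; _∷_; _++_; map; filter; applyUpTo)
open import Data.List.Relation.Binary.Permutation.Propositional using (_↭_)
open import Data.Product using (∃; _×_; _,_)
open import Relation.Binary.PropositionalEquality using (_≡_; _≢_)
open import Relation.Binary.Construct.Closure.ReflexiveTransitive using (Star)
open import Relation.Nullary using (yes; no)

-- Elements of [st] are written x = j*t + r with 0 ≤ j < s and 1 ≤ r ≤ t
-- (i.e. the paper's (j-1)t + r with j shifted by one).
data SawGen (s t : ℕ) : ℕ → ℕ → Set where
  en  : ∀ {j r j' r'} → j < s → 1 ≤ r → r ≤ t → j' < s → 1 ≤ r' → r' ≤ t →
        j' ≤ j → r ≤ r' → SawGen s t (j * t + r) (j' * t + r')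
  saw : ∀ {i} → 2 + i ≤ s → SawGen s t ((2 + i) * t) (i * t + 2)

Saw : ℕ → ℕ → ℕ → ℕ → Set
Saw s t = Star (SawGen s t)

range1 : ℕ → List ℕ
range1 n = applyUpTo suc n

Before : List ℕ → ℕ → ℕ → Set
Before π a b = ∃ λ xs → ∃ λ ys → ∃ λ zs → π ≡ xs ++ a ∷ ys ++ b ∷ zs

LinExt : ℕ → ℕ → List ℕ → Set
LinExt s t π = (π ↭ range1 (s * t)) ×
  (∀ a b → Saw s t a b → a ≢ b → Before π a b)

-- 1-based position of the first occurrence of x in π
pos : ℕ → List ℕ → ℕ
pos x [] = 0
pos x (y ∷ ys) with x ≟ y
... | yes _ = 1
... | no _ = suc (pos x ys)

-- label of a linear extension of a poset on [n]: the j with 1 in position n - j,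
-- i.e. j = n - pos(1).  (For the empty extension, n = 0, this gives 0.)
label : ℕ → List ℕ → ℕ
label n π = n ∸ pos 1 π

restrict : ℕ → List ℕ → List ℕ
restrict t π' = map (λ x → x ∸ t) (filter (t <?_) π')

IsChild : ℕ → ℕ → List ℕ → List ℕ → Set
IsChild s t π π' = LinExt (suc s) t π' × restrict t π' ≡ π

-- In a child π′ of π the entries 2, …, t come last and in increasing order: 1 lies below
-- each of them, and every entry above t lies below 2t, which the sawblade relation puts
-- below 2.  Deleting 1, …, t leaves π shifted by t, so π′ is t + π with 1 inserted
-- somewhere.  Since t + 1 ⪯ 1, the insertion point lies after t + 1, i.e. after the
-- position of 1 in π, and conversely every such insertion point gives a linear
-- extension.  If m entries of π follow the inserted 1, the label of π′ is m + t - 1, and m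
-- ranges exactly over 0, …, label(π).

module Submission where

open import Defs
open import Data.Nat
open import Data.Nat.Properties
open import Data.List using (List; []; _∷_; _++_; length; map; filter; applyUpTo; take; drop)
open import Data.List.Properties
open import Data.List.Membership.Propositional using (_∈_; _∉_)
open import Data.List.Membership.Propositional.Properties
  using (∈-∃++; ∈-++⁺ˡ; ∈-++⁺ʳ; ∈-++⁻; ∈-map⁺; ∈-map⁻; ∈-filter⁺; ∈-filter⁻; ∈-applyUpTo⁺; ∈-applyUpTo⁻)
open import Data.List.Membership.DecPropositional _≟_ using (_∈?_)
open import Data.List.Relation.Unary.Any using (here; there)
open import Data.List.Relation.Unary.All as All using (All; lookup; tabulate)
import Data.List.Relation.Unary.All.Properties as All
open import Data.List.Relation.Unary.AllPairs using (AllPairs; []; _∷_)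
open import Data.List.Relation.Unary.Unique.Propositional using (Unique)
import Data.List.Relation.Unary.Unique.Propositional.Properties as Unique
open import Data.List.Relation.Binary.Permutation.Propositional
  using (_↭_; ↭-sym; ↭⇒↭ₛ; prep; module PermutationReasoning)
import Data.List.Relation.Binary.Permutation.Propositional.Properties as ↭
open import Relation.Binary.Construct.Closure.ReflexiveTransitive using (ε; _◅_)
open import Data.Product using (Σ; ∃; ∃₂; _×_; _,_; proj₁; proj₂)
open import Data.Sum using (_⊎_; inj₁; inj₂)
open import Data.Empty using (⊥; ⊥-elim)
open import Function using (_∘_)
open import Relation.Binary.Definitions using (tri<; tri≈; tri>)
open import Relation.Nullary using (¬_; ¬?; Dec; yes; no; contradiction)
open import Relation.Nullary.Decidable using (_×-dec_)
open import Relation.Unary using (Decidable)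
open import Relation.Binary.PropositionalEquality
open import Data.List.Relation.Binary.Permutation.Setoid.Properties (setoid ℕ) using (Unique-resp-↭)

private variable
  n x y : ℕ
  xs ys zs : List ℕ

-- Positions in lists

pos-head : ∀ x xs → pos x (x ∷ xs) ≡ 1
pos-head x xs with x ≟ x
... | yes _ = refl
... | no x≢x = contradiction refl x≢x

pos-tail : x ≢ y → pos x (y ∷ xs) ≡ suc (pos x xs)
pos-tail {x} {y} x≢y with x ≟ y
... | yes x≡y = contradiction x≡y x≢y
... | no _ = refl

pos≤length : ∀ x xs → pos x xs ≤ length xs
pos≤length x [] = z≤n
pos≤length x (y ∷ xs) with x ≟ y
... | yes _ = s≤s z≤n
... | no _ = s≤s (pos≤length x xs)

pos-positive : x ∈ xs → 0 < pos x xs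
pos-positive {x} {y ∷ xs} _ with x ≟ y
... | yes _ = z<s
... | no _ = z<s

pos-++ˡ : x ∈ xs → pos x (xs ++ ys) ≡ pos x xs
pos-++ˡ {x} {y ∷ xs} x∈ with x ≟ y
... | yes _ = refl
pos-++ˡ (here x≡y) | no x≢y = contradiction x≡y x≢y
pos-++ˡ (there x∈) | no _ = cong suc (pos-++ˡ x∈)

pos-++ʳ : x ∉ xs → pos x (xs ++ ys) ≡ length xs + pos x ys
pos-++ʳ {x} {[]} _ = refl
pos-++ʳ {x} {y ∷ xs} x∉ = trans (pos-tail (x∉ ∘ here)) (cong suc (pos-++ʳ (x∉ ∘ there)))

pos-++-≤⇒∈ˡ : x ∈ xs ++ ys → pos x (xs ++ ys) ≤ length xs → x ∈ xs
pos-++-≤⇒∈ˡ {x} {xs} x∈ pos≤ with x ∈? xs | ∈-++⁻ xs x∈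
... | yes x∈xs | _ = x∈xs
... | no x∉xs | inj₁ x∈xs = contradiction x∈xs x∉xs
... | no x∉xs | inj₂ x∈ys =
  contradiction (subst (_≤ length xs) (pos-++ʳ x∉xs) pos≤) (<⇒≱ (m<m+n (length xs) (pos-positive x∈ys)))

pos-injective : x ∈ xs → y ∈ xs → pos x xs ≡ pos y xs → x ≡ y
pos-injective {x} {z ∷ xs} {y} x∈ y∈ eq with x ≟ z | y ≟ z
... | yes refl | yes refl = refl
pos-injective (here x≡z) _ _ | no x≢z | _ = contradiction x≡z x≢z
pos-injective _ (here y≡z) _ | _ | no y≢z = contradiction y≡z y≢z
pos-injective _ (there y∈) eq | yes _ | no _ = contradiction (suc-injective eq) (<⇒≢ (pos-positive y∈))
pos-injective (there x∈) _ eq | no _ | yes _ = contradiction (suc-injective eq) (>⇒≢ (pos-positive x∈))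
pos-injective (there x∈) (there y∈) eq | no _ | no _ = pos-injective x∈ y∈ (suc-injective eq)

pos-map : ∀ {f : ℕ → ℕ} → (∀ {a b} → f a ≡ f b → a ≡ b) →
          ∀ x xs → pos (f x) (map f xs) ≡ pos x xs
pos-map f-inj x [] = refl
pos-map {f} f-inj x (y ∷ xs) with f x ≟ f y | x ≟ y
... | yes _ | yes _ = refl
... | yes fx≡fy | no x≢y = contradiction (f-inj fx≡fy) x≢y
... | no fx≢fy | yes x≡y = contradiction (cong f x≡y) fx≢fy
... | no _ | no _ = cong suc (pos-map f-inj x xs)

pos-applyUpTo : ∀ {f : ℕ → ℕ} → (∀ {a b} → f a ≡ f b → a ≡ b) →
                ∀ {i n} → i < n → pos (f i) (applyUpTo f n) ≡ suc i
pos-applyUpTo {f} f-inj {zero} (s≤s _) = pos-head (f 0) _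
pos-applyUpTo {f} f-inj {suc i} (s≤s i<n) =
  trans (pos-tail (1+n≢0 ∘ f-inj))
        (cong suc (pos-applyUpTo (suc-injective ∘ f-inj) i<n))

Before-∈ˡ : Before xs x y → x ∈ xs
Before-∈ˡ {x = x} (ws , us , vs , refl) = ∈-++⁺ʳ ws (here refl)

Before-∈ʳ : Before xs x y → y ∈ xs
Before-∈ʳ {x = x} {y} (ws , us , vs , refl) = ∈-++⁺ʳ ws (there (∈-++⁺ʳ us (here refl)))

Before-++⁺ʳ : ∀ xs → Before ys x y → Before (xs ++ ys) x y
Before-++⁺ʳ {x = x} {y} xs (ws , us , vs , refl) = xs ++ ws , us , vs , sym (++-assoc xs ws (x ∷ us ++ y ∷ vs))

pos<⇒Before : x ∈ xs → y ∈ xs → pos x xs < pos y xs → Before xs x y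
pos<⇒Before {x} {z ∷ _} {y} x∈ y∈ lt with x ≟ z | y ≟ z
pos<⇒Before _ _ (s≤s ()) | yes _ | yes _
pos<⇒Before _ _ (s≤s ()) | no _ | yes _
pos<⇒Before _ (here y≡z) _ | _ | no y≢z = contradiction y≡z y≢z
pos<⇒Before _ (there y∈) _ | yes refl | no _ with ys , zs , refl ← ∈-∃++ y∈ = [] , ys , zs , refl
pos<⇒Before (here x≡z) _ _ | no x≢z | no _ = contradiction x≡z x≢z
pos<⇒Before {xs = z ∷ _} (there x∈) (there y∈) (s≤s lt) | no _ | no _
  with ws , us , vs , eq ← pos<⇒Before x∈ y∈ lt = z ∷ ws , us , vs , cong (z ∷_) eq

Before⇒pos< : Unique xs → Before xs x y → pos x xs < pos y xs
Before⇒pos< {x = x} {y} (x∉ ∷ _) ([] , us , vs , refl) =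
  subst₂ _<_ (sym (pos-head x _)) (sym (pos-tail (≢-sym (lookup x∉ y∈)))) (s≤s (pos-positive y∈))
  where y∈ = ∈-++⁺ʳ us (here refl)
Before⇒pos< {x = x} {y} (w∉ ∷ uniq) (w ∷ ws , us , vs , refl) =
  subst₂ _<_ (sym (pos-tail (≢-sym (lookup w∉ x∈)))) (sym (pos-tail (≢-sym (lookup w∉ y∈))))
    (s≤s (Before⇒pos< uniq (ws , us , vs , refl)))
  where
  x∈ = ∈-++⁺ʳ ws (here refl)
  y∈ = ∈-++⁺ʳ ws (there (∈-++⁺ʳ us (here refl)))

Before-asym : Unique xs → Before xs x y → ¬ Before xs y x
Before-asym uniq xy yx = <-asym (Before⇒pos< uniq xy) (Before⇒pos< uniq yx)

Before⇒≢ : Unique xs → Before xs x y → x ≢ y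
Before⇒≢ uniq xy refl = Before-asym uniq xy xy

Unique-++⇒∉ˡ : Unique (xs ++ y ∷ ys) → y ∉ xs
Unique-++⇒∉ˡ {a ∷ xs} (a∉ ∷ _) (here refl) = lookup a∉ (∈-++⁺ʳ xs (here refl)) refl
Unique-++⇒∉ˡ {a ∷ xs} (_ ∷ uniq) (there y∈) = Unique-++⇒∉ˡ uniq y∈

Unique-++⇒∉ʳ : Unique (xs ++ y ∷ ys) → y ∉ ys
Unique-++⇒∉ʳ {[]} uniq = Unique.Unique[x∷xs]⇒x∉xs uniq
Unique-++⇒∉ʳ {a ∷ xs} (_ ∷ uniq) = Unique-++⇒∉ʳ {xs} uniq

Before-∈-prefix : Unique (xs ++ y ∷ ys) → Before (xs ++ y ∷ ys) x y → x ∈ xs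
Before-∈-prefix {xs} {y} {ys} {x} uniq x-before-y =
  pos-++-≤⇒∈ˡ (Before-∈ˡ x-before-y)
    (≤-pred (subst (pos x (xs ++ y ∷ ys) <_) pos-y (Before⇒pos< uniq x-before-y)))
  where
  pos-y : pos y (xs ++ y ∷ ys) ≡ suc (length xs)
  pos-y = trans (pos-++ʳ (Unique-++⇒∉ˡ uniq)) (trans (cong (length xs +_) (pos-head y ys)) (+-comm (length xs) 1))

Before⇒AllPairs : ∀ {R : ℕ → ℕ → Set} xs → (∀ {x y} → Before xs x y → R x y) → AllPairs R xs
Before⇒AllPairs [] _ = []
Before⇒AllPairs (x ∷ xs) before⇒R =
  tabulate (λ y∈ → let us , vs , eq = ∈-∃++ y∈ in before⇒R ([] , us , vs , cong (x ∷_) eq))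
  ∷ Before⇒AllPairs xs (before⇒R ∘ Before-++⁺ʳ (x ∷ []))

module _ {Q : ℕ → Set} (Q? : Decidable Q) where

  ++-filter-split : ∀ xs → (∀ {x y} → Before xs x y → Q x → ¬ Q y → ⊥) →
                    xs ≡ filter (¬? ∘ Q?) xs ++ filter Q? xs
  ++-filter-split [] _ = refl
  ++-filter-split (x ∷ xs) sorted with Q? x
  ... | no ¬qx = cong (x ∷_) (++-filter-split xs (sorted ∘ Before-++⁺ʳ (x ∷ [])))
  ... | yes qx = sym (begin
    filter (¬? ∘ Q?) xs ++ x ∷ filter Q? xs ≡⟨ cong₂ (λ as bs → as ++ x ∷ bs) none-violate all-satisfy ⟩
    x ∷ xs                                   ∎)
    where
    open ≡-Reasoning
    allQ : ∀ {y} → y ∈ xs → Q y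
    allQ {y} y∈ with Q? y
    ... | yes qy = qy
    ... | no ¬qy = let us , vs , eq = ∈-∃++ y∈ in ⊥-elim (sorted ([] , us , vs , cong (x ∷_) eq) qx ¬qy)
    none-violate : filter (¬? ∘ Q?) xs ≡ []
    none-violate = filter-none (¬? ∘ Q?) (tabulate (λ y∈ ¬qy → ¬qy (allQ y∈)))
    all-satisfy : filter Q? xs ≡ xs
    all-satisfy = filter-all Q? (tabulate allQ)

-- Intervals of ℕ as lists

++-≡-by-length : ∀ {ws xs : List ℕ} → length ws ≡ length xs → ws ++ ys ≡ xs ++ zs → ws ≡ xs × ys ≡ zs
++-≡-by-length {ws = []} {[]} _ eq = refl , eq
++-≡-by-length {ws = w ∷ ws} {x ∷ xs} len eq with refl , eq′ ← ∷-injective eq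
  with refl , refl ← ++-≡-by-length {ws = ws} {xs} (suc-injective len) eq′ = refl , refl

applyUpTo-cong : ∀ {f g : ℕ → ℕ} n → (∀ i → f i ≡ g i) → applyUpTo f n ≡ applyUpTo g n
applyUpTo-cong zero _ = refl
applyUpTo-cong (suc n) f≗g = cong₂ _∷_ (f≗g 0) (applyUpTo-cong n (f≗g ∘ suc))

applyUpTo-+ : ∀ (f : ℕ → ℕ) m n → applyUpTo f (m + n) ≡ applyUpTo f m ++ applyUpTo (f ∘ (m +_)) n
applyUpTo-+ f zero n = refl
applyUpTo-+ f (suc m) n = cong (f 0 ∷_) (applyUpTo-+ (f ∘ suc) m n)

increasing-interval : ∀ c n {xs} → AllPairs _<_ xs →
                      (∀ {x} → x ∈ xs → c ≤ x × x < c + n) →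
                      (∀ {x} → c ≤ x → x < c + n → x ∈ xs) →
                      xs ≡ applyUpTo (c +_) n
increasing-interval c zero {[]} _ _ _ = refl
increasing-interval c zero {a ∷ _} _ bounded _ =
  let c≤a , a<c+0 = bounded (here refl) in contradiction (subst (a <_) (+-identityʳ c) a<c+0) (≤⇒≯ c≤a)
increasing-interval c (suc n) {[]} _ _ complete with () ← complete ≤-refl (m<m+n c z<s)
increasing-interval c (suc n) {a ∷ xs} (a<xs ∷ increasing) bounded complete =
  cong₂ _∷_ (trans (sym c≡a) (sym (+-identityʳ c)))
    (trans (increasing-interval (suc c) n increasing bounded′ complete′) (applyUpTo-cong n (sym ∘ +-suc c)))
  where
  c≡a : c ≡ a
  c≡a with complete ≤-refl (m<m+n c z<s)
  ... | here c≡a = c≡a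
  ... | there c∈ = contradiction (lookup a<xs c∈) (≤⇒≯ (proj₁ (bounded (here refl))))
  bounded′ : ∀ {x} → x ∈ xs → suc c ≤ x × x < suc c + n
  bounded′ {x} x∈ =
    subst (_< x) (sym c≡a) (lookup a<xs x∈) , subst (x <_) (+-suc c n) (proj₂ (bounded (there x∈)))
  complete′ : ∀ {x} → suc c ≤ x → x < suc c + n → x ∈ xs
  complete′ {x} c<x x<c+n with complete (<⇒≤ c<x) (subst (x <_) (sym (+-suc c n)) x<c+n)
  ... | here x≡a = contradiction (trans x≡a (sym c≡a)) (>⇒≢ c<x)
  ... | there x∈ = x∈

range1-+ : ∀ m n → range1 (m + n) ≡ range1 m ++ map (m +_) (range1 n)
range1-+ m n = begin
  range1 (m + n)                             ≡⟨ applyUpTo-+ suc m n ⟩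
  range1 m ++ applyUpTo (suc ∘ (m +_)) n     ≡⟨ cong (range1 m ++_) (applyUpTo-cong n (sym ∘ +-suc m)) ⟩
  range1 m ++ applyUpTo ((m +_) ∘ suc) n     ≡⟨ cong (range1 m ++_) (map-applyUpTo suc (m +_) n) ⟨
  range1 m ++ map (m +_) (range1 n)          ∎
  where open ≡-Reasoning

∈-range1⁻ : x ∈ range1 n → 1 ≤ x × x ≤ n
∈-range1⁻ x∈ with _ , i<n , refl ← ∈-applyUpTo⁻ suc x∈ = s≤s z≤n , i<n

∈-range1⁺ : 1 ≤ x → x ≤ n → x ∈ range1 n
∈-range1⁺ {suc x} _ x<n = ∈-applyUpTo⁺ suc x<n

Unique-range1 : ∀ n → Unique (range1 n)
Unique-range1 n = Unique.applyUpTo⁺₁ suc n (λ i<j _ → <⇒≢ i<j ∘ suc-injective)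

module _ (xs↭ : xs ↭ range1 n) where

  Unique-↭range1 : Unique xs
  Unique-↭range1 = Unique-resp-↭ (↭⇒↭ₛ (↭-sym xs↭)) (Unique-range1 n)

  ∈-↭range1⁻ : x ∈ xs → 1 ≤ x × x ≤ n
  ∈-↭range1⁻ = ∈-range1⁻ ∘ ↭.∈-resp-↭ xs↭

  ∈-↭range1⁺ : 1 ≤ x → x ≤ n → x ∈ xs
  ∈-↭range1⁺ 1≤x x≤n = ↭.∈-resp-↭ (↭-sym xs↭) (∈-range1⁺ 1≤x x≤n)

  length-↭range1 : length xs ≡ n
  length-↭range1 = trans (↭.↭-length xs↭) (length-applyUpTo suc n)

-- The blocks of SAW_{s,t}

block≤ : ∀ {j n r t} → j < n → r ≤ t → j * t + r ≤ n * t
block≤ {j} {n} {r} {t} j<n r≤t = begin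
  j * t + r ≤⟨ +-monoʳ-≤ (j * t) r≤t ⟩
  j * t + t ≡⟨ +-comm (j * t) t ⟩
  suc j * t ≤⟨ *-monoˡ-≤ t j<n ⟩
  n * t     ∎
  where open ≤-Reasoning

block-decomposition : ∀ {x} n t → 1 ≤ x → x ≤ n * t →
                      ∃₂ λ j r → j < n × 1 ≤ r × r ≤ t × x ≡ j * t + r
block-decomposition zero t 1≤x x≤0 = contradiction x≤0 (<⇒≱ 1≤x)
block-decomposition {x} (suc n) t 1≤x x≤ with x ≤? t
... | yes x≤t = 0 , x , z<s , 1≤x , x≤t , refl
... | no x≰t = next-block (block-decomposition n t (m<n⇒0<n∸m t<x) x∸t≤)
  where
  t<x = ≰⇒> x≰t
  x∸t≤ : x ∸ t ≤ n * t
  x∸t≤ = subst (x ∸ t ≤_) (m+n∸m≡n t (n * t)) (∸-monoˡ-≤ t x≤)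
  next-block : ∃₂ (λ j r → j < n × 1 ≤ r × r ≤ t × x ∸ t ≡ j * t + r) →
               ∃₂ (λ j r → j < suc n × 1 ≤ r × r ≤ t × x ≡ j * t + r)
  next-block (j , r , j<n , 1≤r , r≤t , x∸t≡) = suc j , r , s≤s j<n , 1≤r , r≤t , (begin
    x               ≡⟨ m+[n∸m]≡n (<⇒≤ t<x) ⟨
    t + (x ∸ t)     ≡⟨ cong (t +_) x∸t≡ ⟩
    t + (j * t + r) ≡⟨ +-assoc t (j * t) r ⟨
    suc j * t + r   ∎)
    where open ≡-Reasoning

SawGen-bounds : ∀ {n t a b} → SawGen n (suc t) a b → (1 ≤ a × a ≤ n * suc t) × (1 ≤ b × b ≤ n * suc t)
SawGen-bounds (en {j} {r} {j'} {r'} j<n 1≤r r≤t j'<n 1≤r' r'≤t _ _) =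
  (≤-trans 1≤r (m≤n+m r (j * _)) , block≤ j<n r≤t) ,
  (≤-trans 1≤r' (m≤n+m r' (j' * _)) , block≤ j'<n r'≤t)
SawGen-bounds {n} {t} (saw {i} 2+i≤n) =
  (z<s , *-monoˡ-≤ (suc t) 2+i≤n) , (≤-trans (s≤s z≤n) (m≤n+m 2 (i * suc t)) , b≤)
  where
  open ≤-Reasoning
  b≤ : i * suc t + 2 ≤ n * suc t
  b≤ = begin
    i * suc t + 2           ≡⟨ +-suc (i * suc t) 1 ⟩
    1 + (i * suc t + 1)     ≤⟨ +-monoˡ-≤ (i * suc t + 1) (s≤s (z≤n {t})) ⟩
    suc t + (i * suc t + 1) ≡⟨ +-assoc (suc t) (i * suc t) 1 ⟨
    suc i * suc t + 1       ≤⟨ block≤ 2+i≤n (s≤s z≤n) ⟩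
    n * suc t               ∎

Saw-bounds : ∀ {n t a b} → Saw n (suc t) a b → a ≢ b → (1 ≤ a × a ≤ n * suc t) × (1 ≤ b × b ≤ n * suc t)
Saw-bounds ε a≢a = contradiction refl a≢a
Saw-bounds {b = b} (_◅_ {j = c} g c⪯b) a≢b with c ≟ b
... | yes refl = SawGen-bounds g
... | no c≢b = proj₁ (SawGen-bounds g) , proj₂ (Saw-bounds c⪯b c≢b)

linExt-by-pos : ∀ {n t π} → π ↭ range1 (n * suc t) →
                (∀ {a b} → SawGen n (suc t) a b → pos a π ≤ pos b π) → LinExt n (suc t) π
linExt-by-pos {n} {t} {π} π↭ gen-mono = π↭ , before
  where
  mono : ∀ {a b} → Saw n (suc t) a b → pos a π ≤ pos b π
  mono ε = ≤-refl
  mono (a⪯c ◅ c⪯b) = ≤-trans (gen-mono a⪯c) (mono c⪯b)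
  before : ∀ a b → Saw n (suc t) a b → a ≢ b → Before π a b
  before a b a⪯b a≢b = pos<⇒Before a∈ b∈ (≤∧≢⇒< (mono a⪯b) (a≢b ∘ pos-injective a∈ b∈))
    where
    bounds = Saw-bounds a⪯b a≢b
    a∈ = ∈-↭range1⁺ π↭ (proj₁ (proj₁ bounds)) (proj₂ (proj₁ bounds))
    b∈ = ∈-↭range1⁺ π↭ (proj₁ (proj₂ bounds)) (proj₂ (proj₂ bounds))

-- Children as insertions of 1

lift : ℕ → List ℕ → List ℕ
lift t = map (t +_)

restrict-++ : ∀ t xs ys → restrict t (xs ++ ys) ≡ restrict t xs ++ restrict t ys
restrict-++ t xs ys = trans (cong (map (_∸ t)) (filter-++ (t <?_) xs ys)) (map-++ (_∸ t) (filter (t <?_) xs) _)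

restrict-lift : ∀ t {xs} → All (0 <_) xs → restrict t (lift t xs) ≡ xs
restrict-lift t {xs} xs-pos = begin
  map (_∸ t) (filter (t <?_) (lift t xs)) ≡⟨ cong (map (_∸ t)) (filter-all (t <?_) lifted-big) ⟩
  map (_∸ t) (map (t +_) xs)              ≡⟨ map-∘ xs ⟨
  map ((_∸ t) ∘ (t +_)) xs                ≡⟨ map-id-local (tabulate (λ {x} _ → m+n∸m≡n t x)) ⟩
  xs                                      ∎
  where
  open ≡-Reasoning
  lifted-big : All (t <_) (lift t xs)
  lifted-big = All.map⁺ (All.map (m<m+n t) xs-pos)

lift-restrict : ∀ t {xs} → All (t <_) xs → lift t (restrict t xs) ≡ xs
lift-restrict t {xs} xs-big = begin
  map (t +_) (map (_∸ t) (filter (t <?_) xs)) ≡⟨ cong (map (t +_) ∘ map (_∸ t)) (filter-all (t <?_) xs-big) ⟩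
  map (t +_) (map (_∸ t) xs)                  ≡⟨ map-∘ xs ⟨
  map ((t +_) ∘ (_∸ t)) xs                    ≡⟨ map-id-local (All.map (m+[n∸m]≡n ∘ <⇒≤) xs-big) ⟩
  xs                                          ∎
  where open ≡-Reasoning

restrict-small : ∀ t {xs} → All (_≤ t) xs → restrict t xs ≡ []
restrict-small t xs-small = cong (map (_∸ t)) (filter-none (t <?_) (All.map ≤⇒≯ xs-small))

child : ℕ → List ℕ → List ℕ → List ℕ
child t U V = (lift t U ++ 1 ∷ lift t V) ++ applyUpTo (2 +_) (t ∸ 1)

record Split (π : List ℕ) : Set where
  constructor split
  field
    front back : List ℕ
    front++back : front ++ back ≡ π
    1∈front : 1 ∈ front

module Children (s t′ : ℕ) (1≤s : 1 ≤ s) (π : List ℕ) (π-lin : LinExt s (suc t′) π) where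

  t : ℕ
  t = suc t′

  private
    π↭ = proj₁ π-lin
    π-unique = Unique-↭range1 π↭

  ∈π⁻ : ∀ {x} → x ∈ π → 1 ≤ x × x ≤ s * t
  ∈π⁻ = ∈-↭range1⁻ π↭

  ∈π⁺ : ∀ {x} → 1 ≤ x → x ≤ s * t → x ∈ π
  ∈π⁺ = ∈-↭range1⁺ π↭

  ⪯⇒pos≤ : ∀ {a b} → SawGen s t a b → pos a π ≤ pos b π
  ⪯⇒pos≤ {a} {b} a⪯b with a ≟ b
  ... | yes refl = ≤-refl
  ... | no a≢b = <⇒≤ (Before⇒pos< π-unique (proj₂ π-lin a b (a⪯b ◅ ε) a≢b))

  SawGen-∈π : ∀ {a b} → SawGen s t a b → a ∈ π × b ∈ π
  SawGen-∈π a⪯b = let (1≤a , a≤) , (1≤b , b≤) = SawGen-bounds a⪯b in ∈π⁺ 1≤a a≤ , ∈π⁺ 1≤b b≤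

  Small : ℕ → Set
  Small x = 2 ≤ x × x ≤ t

  small? : (x : ℕ) → Dec (Small x)
  small? x = (2 ≤? x) ×-dec (x ≤? t)

  small-⪯ : ∀ {x y} → Small x → Small y → x ≤ y → SawGen (suc s) t x y
  small-⪯ (2≤x , x≤t) (2≤y , y≤t) = en z<s (≤-trans (s≤s z≤n) 2≤x) x≤t z<s (≤-trans (s≤s z≤n) 2≤y) y≤t z≤n

  childAt : Split π → List ℕ
  childAt sp = child t (Split.front sp) (Split.back sp)

  length-split : (sp : Split π) → length (Split.front sp) + length (Split.back sp) ≡ s * t
  length-split (split U V U++V≡π _) = trans (sym (length-++ U)) (trans (cong length U++V≡π) (length-↭range1 π↭))

  pos-one≤length-front : (sp : Split π) → pos 1 π ≤ length (Split.front sp)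
  pos-one≤length-front (split U V U++V≡π 1∈U) =
    subst (_≤ length U) (trans (sym (pos-++ˡ {ys = V} 1∈U)) (cong (pos 1) U++V≡π)) (pos≤length 1 U)

  length-back≤label : (sp : Split π) → length (Split.back sp) ≤ label (s * t) π
  length-back≤label sp@(split U V _ _) = begin
    length V                 ≡⟨ m+n∸m≡n (length U) (length V) ⟨
    length U + length V ∸ length U ≡⟨ cong (_∸ length U) (length-split sp) ⟩
    s * t ∸ length U         ≤⟨ ∸-monoʳ-≤ (s * t) (pos-one≤length-front sp) ⟩
    s * t ∸ pos 1 π          ∎
    where open ≤-Reasoning

  split-with-back-length : ∀ m → m ≤ label (s * t) π → Σ (Split π) λ sp → length (Split.back sp) ≡ m
  split-with-back-length m m≤label =
    split (take k π) (drop k π) (take++drop≡id k π) 1∈take , length-drop-k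
    where
    open ≤-Reasoning
    k = s * t ∸ m
    length-π = length-↭range1 π↭
    pos-one≤st : pos 1 π ≤ s * t
    pos-one≤st = subst (pos 1 π ≤_) length-π (pos≤length 1 π)
    m≤st : m ≤ s * t
    m≤st = ≤-trans m≤label (m∸n≤m (s * t) (pos 1 π))
    length-take-k : length (take k π) ≡ k
    length-take-k = trans (length-take k π) (m≤n⇒m⊓n≡m (subst (k ≤_) (sym length-π) (m∸n≤m (s * t) m)))
    length-drop-k : length (drop k π) ≡ m
    length-drop-k = trans (length-drop k π) (trans (cong (_∸ k) length-π) (m∸[m∸n]≡n m≤st))
    pos-one≤k : pos 1 π ≤ k
    pos-one≤k = begin
      pos 1 π                   ≡⟨ m∸[m∸n]≡n pos-one≤st ⟨
      s * t ∸ label (s * t) π   ≤⟨ ∸-monoʳ-≤ (s * t) m≤label ⟩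
      k                         ∎
    1∈take : 1 ∈ take k π
    1∈take = pos-++-≤⇒∈ˡ (subst (1 ∈_) (sym (take++drop≡id k π)) (∈π⁺ ≤-refl (*-mono-≤ 1≤s (s≤s z≤n))))
                         (subst₂ _≤_ (cong (pos 1) (sym (take++drop≡id k π))) (sym length-take-k) pos-one≤k)

  childAt-≡-by-length : (sp₁ sp₂ : Split π) → length (Split.back sp₁) ≡ length (Split.back sp₂) →
                        childAt sp₁ ≡ childAt sp₂
  childAt-≡-by-length sp₁@(split U₁ V₁ U₁++V₁≡π _) sp₂@(split U₂ V₂ U₂++V₂≡π _) |V₁|≡|V₂| =
    let U₁≡U₂ , V₁≡V₂ = ++-≡-by-length |U₁|≡|U₂| (trans U₁++V₁≡π (sym U₂++V₂≡π))
    in cong₂ (child t) U₁≡U₂ V₁≡V₂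
    where
    |U₁|≡|U₂| : length U₁ ≡ length U₂
    |U₁|≡|U₂| = +-cancelʳ-≡ (length V₁) _ _
      (trans (length-split sp₁) (trans (sym (length-split sp₂)) (cong (length U₂ +_) (sym |V₁|≡|V₂|))))

  module Insertion (sp : Split π) where
    open Split sp renaming (front to U; back to V)

    D R C : List ℕ
    D = lift t U ++ 1 ∷ lift t V
    R = applyUpTo (2 +_) t′
    C = D ++ R

    ∈U⇒∈π : ∀ {x} → x ∈ U → x ∈ π
    ∈U⇒∈π = subst (_ ∈_) front++back ∘ ∈-++⁺ˡ

    ∈V⇒∈π : ∀ {x} → x ∈ V → x ∈ π
    ∈V⇒∈π = subst (_ ∈_) front++back ∘ ∈-++⁺ʳ U

    pos-π : ∀ x → pos x π ≡ pos x (U ++ V)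
    pos-π x = cong (pos x) (sym front++back)

    ∈π⇒∈UV : ∀ {x} → x ∈ π → x ∈ U ++ V
    ∈π⇒∈UV = subst (_ ∈_) (sym front++back)

    lift-big : ∀ {z W} → (∀ {x} → x ∈ W → x ∈ π) → z ∈ lift t W → t < z
    lift-big W⊆π z∈ with x , x∈ , refl ← ∈-map⁻ (t +_) z∈ = m<m+n t (proj₁ (∈π⁻ (W⊆π x∈)))

    D-elements : ∀ {z} → z ∈ D → z ≡ 1 ⊎ t < z
    D-elements z∈ with ∈-++⁻ (lift t U) z∈
    ... | inj₁ z∈U = inj₂ (lift-big ∈U⇒∈π z∈U)
    ... | inj₂ (here z≡1) = inj₁ z≡1
    ... | inj₂ (there z∈V) = inj₂ (lift-big ∈V⇒∈π z∈V)

    1∉lift : ∀ {W} → (∀ {x} → x ∈ W → x ∈ π) → 1 ∉ lift t W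
    1∉lift W⊆π 1∈ = contradiction (lift-big W⊆π 1∈) (≤⇒≯ (s≤s z≤n))

    pos-D : ∀ {z} → z ∈ D → pos z C ≤ length D
    pos-D {z} z∈ = subst (_≤ length D) (sym (pos-++ˡ {ys = R} z∈)) (pos≤length z D)

    pos-one : pos 1 C ≡ suc (length U)
    pos-one = begin
      pos 1 C                          ≡⟨ pos-++ˡ {ys = R} (∈-++⁺ʳ (lift t U) (here refl)) ⟩
      pos 1 D                          ≡⟨ pos-++ʳ {ys = 1 ∷ lift t V} (1∉lift ∈U⇒∈π) ⟩
      length (lift t U) + pos 1 (1 ∷ lift t V) ≡⟨ cong₂ _+_ (length-map (t +_) U) (pos-head 1 (lift t V)) ⟩
      length U + 1                     ≡⟨ +-comm (length U) 1 ⟩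
      suc (length U)                   ∎
      where open ≡-Reasoning

    pos-small : ∀ {i} → i < t′ → pos (2 + i) C ≡ length D + suc i
    pos-small {i} i<t′ =
      trans (pos-++ʳ {ys = R} 2+i∉D) (cong (length D +_) (pos-applyUpTo (suc-injective ∘ suc-injective) i<t′))
      where
      2+i∉D : 2 + i ∉ D
      2+i∉D 2+i∈ with D-elements 2+i∈
      ... | inj₂ t<2+i = contradiction (s≤s i<t′) (<⇒≱ t<2+i)

    pos-lift-front : ∀ {x} → x ∈ π → pos x π ≤ length U → pos (t + x) C ≡ pos x π
    pos-lift-front {x} x∈ pos≤ = begin
      pos (t + x) C               ≡⟨ pos-++ˡ {ys = R} (∈-++⁺ˡ t+x∈) ⟩
      pos (t + x) D               ≡⟨ pos-++ˡ {ys = 1 ∷ lift t V} t+x∈ ⟩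
      pos (t + x) (lift t U)      ≡⟨ pos-map (+-cancelˡ-≡ t _ _) x U ⟩
      pos x U                     ≡⟨ pos-++ˡ {ys = V} x∈U ⟨
      pos x (U ++ V)              ≡⟨ pos-π x ⟨
      pos x π                     ∎
      where
      open ≡-Reasoning
      x∈U : x ∈ U
      x∈U = pos-++-≤⇒∈ˡ (∈π⇒∈UV x∈) (subst (_≤ length U) (pos-π x) pos≤)
      t+x∈ = ∈-map⁺ (t +_) x∈U

    pos-lift-back : ∀ {x} → x ∈ π → length U < pos x π → pos (t + x) C ≡ suc (pos x π)
    pos-lift-back {x} x∈ U<pos = begin
      pos (t + x) C                                      ≡⟨ pos-++ˡ {ys = R} (∈-++⁺ʳ (lift t U) (there t+x∈)) ⟩
      pos (t + x) D                                      ≡⟨ pos-++ʳ {ys = 1 ∷ lift t V} (x∉U ∘ lift⁻) ⟩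
      length (lift t U) + pos (t + x) (1 ∷ lift t V)     ≡⟨ cong₂ _+_ (length-map (t +_) U) (pos-tail t+x≢1) ⟩
      length U + suc (pos (t + x) (lift t V))            ≡⟨ cong (λ p → length U + suc p) (pos-map (+-cancelˡ-≡ t _ _) x V) ⟩
      length U + suc (pos x V)                           ≡⟨ +-suc (length U) (pos x V) ⟩
      suc (length U + pos x V)                           ≡⟨ cong suc (pos-++ʳ {ys = V} x∉U) ⟨
      suc (pos x (U ++ V))                               ≡⟨ cong suc (pos-π x) ⟨
      suc (pos x π)                                      ∎
      where
      open ≡-Reasoning
      t+x≢1 : t + x ≢ 1
      t+x≢1 = >⇒≢ (≤-trans (s≤s (s≤s z≤n)) (m<m+n t (proj₁ (∈π⁻ x∈))))
      x∉U : x ∉ U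
      x∉U x∈U = <⇒≱ U<pos
        (subst (_≤ length U) (trans (sym (pos-++ˡ {ys = V} x∈U)) (sym (pos-π x))) (pos≤length x U))
      x∈V : x ∈ V
      x∈V with ∈-++⁻ U (∈π⇒∈UV x∈)
      ... | inj₁ x∈U = contradiction x∈U x∉U
      ... | inj₂ x∈V = x∈V
      t+x∈ = ∈-map⁺ (t +_) x∈V
      lift⁻ : t + x ∈ lift t U → x ∈ U
      lift⁻ t+x∈ with y , y∈ , t+x≡t+y ← ∈-map⁻ (t +_) t+x∈ =
        subst (_∈ U) (sym (+-cancelˡ-≡ t x y t+x≡t+y)) y∈

    lift-mono : ∀ {x y} → x ∈ π → y ∈ π → pos x π ≤ pos y π → pos (t + x) C ≤ pos (t + y) C
    lift-mono {x} {y} x∈ y∈ x≤y with pos x π ≤? length U | pos y π ≤? length U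
    ... | yes x≤U | yes y≤U =
      subst₂ _≤_ (sym (pos-lift-front x∈ x≤U)) (sym (pos-lift-front y∈ y≤U)) x≤y
    ... | yes x≤U | no y≰U =
      subst₂ _≤_ (sym (pos-lift-front x∈ x≤U)) (sym (pos-lift-back y∈ (≰⇒> y≰U))) (m≤n⇒m≤1+n x≤y)
    ... | no x≰U | yes y≤U = contradiction (≤-trans x≤y y≤U) x≰U
    ... | no x≰U | no y≰U =
      subst₂ _≤_ (sym (pos-lift-back x∈ (≰⇒> x≰U))) (sym (pos-lift-back y∈ (≰⇒> y≰U))) (s≤s x≤y)

    lift-gen : ∀ {a b} → SawGen s t a b → pos (t + a) C ≤ pos (t + b) C
    lift-gen a⪯b = lift-mono (proj₁ (SawGen-∈π a⪯b)) (proj₂ (SawGen-∈π a⪯b)) (⪯⇒pos≤ a⪯b)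

    lift-before-one : ∀ {x} → x ∈ π → pos x π ≤ pos 1 π → pos (t + x) C < pos 1 C
    lift-before-one {x} x∈ x≤1 = subst₂ _<_ (sym (pos-lift-front x∈ x≤U)) (sym pos-one) (s≤s x≤U)
      where
      x≤U : pos x π ≤ length U
      x≤U = ≤-trans x≤1 (pos-one≤length-front sp)

    D-before-small : ∀ {z i} → z ∈ D → i < t′ → pos z C ≤ pos (2 + i) C
    D-before-small {z} {i} z∈ i<t′ =
      ≤-trans (pos-D z∈) (subst (length D ≤_) (sym (pos-small i<t′)) (m≤m+n (length D) (suc i)))

    lifted-∈D : ∀ {x} → x ∈ π → t + x ∈ D
    lifted-∈D x∈ with ∈-++⁻ U (∈π⇒∈UV x∈)
    ... | inj₁ x∈U = ∈-++⁺ˡ (∈-map⁺ (t +_) x∈U)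
    ... | inj₂ x∈V = ∈-++⁺ʳ (lift t U) (there (∈-map⁺ (t +_) x∈V))

    bottom-mono : ∀ {r r′} → 1 ≤ r → r ≤ r′ → r′ ≤ t → pos r C ≤ pos r′ C
    bottom-mono {1} {1} _ _ _ = ≤-refl
    bottom-mono {suc (suc _)} {1} _ (s≤s ()) _
    bottom-mono {1} {suc (suc i′)} _ _ r′≤t = D-before-small (∈-++⁺ʳ (lift t U) (here refl)) (≤-pred r′≤t)
    bottom-mono {suc (suc i)} {suc (suc i′)} _ r≤r′ r′≤t =
      subst₂ _≤_ (sym (pos-small (<-≤-trans (≤-pred r≤r′) (≤-pred r′≤t)))) (sym (pos-small (≤-pred r′≤t)))
        (+-monoʳ-≤ (length D) (≤-pred r≤r′))

    lifted-before-bottom : ∀ {j r r′} → j < s → 1 ≤ r → r ≤ t → r ≤ r′ → r′ ≤ t →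
                           pos (t + (j * t + r)) C ≤ pos r′ C
    lifted-before-bottom {j} {1} {1} j<s 1≤r r≤t _ _ =
      <⇒≤ (lift-before-one (proj₁ (SawGen-∈π x⪯1)) (⪯⇒pos≤ x⪯1))
      where x⪯1 = en {j' = 0} j<s 1≤r r≤t (≤-trans (s≤s z≤n) 1≤s) 1≤r r≤t z≤n ≤-refl
    lifted-before-bottom {j} {r} {suc (suc i′)} j<s 1≤r r≤t _ r′≤t =
      D-before-small (lifted-∈D (∈π⁺ (≤-trans 1≤r (m≤n+m r (j * t))) (block≤ j<s r≤t))) (≤-pred r′≤t)
    lifted-before-bottom {r = suc (suc _)} {1} _ _ _ (s≤s ()) _

    saw-bottom : pos (2 * t) C ≤ pos 2 C
    saw-bottom with t′ ≟ 0
    ... | yes refl = ≤-refl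
    ... | no t′≢0 = D-before-small (lifted-∈D (∈π⁺ (s≤s z≤n) (*-monoˡ-≤ t 1≤s))) (n≢0⇒n>0 t′≢0)

    gen-mono : ∀ {a b} → SawGen (suc s) t a b → pos a C ≤ pos b C
    gen-mono (en {zero} {r} {zero} 0<1+s 1≤r _ _ _ r′≤t _ r≤r′) = bottom-mono 1≤r r≤r′ r′≤t
    gen-mono (en {zero} {j' = suc _} _ _ _ _ _ _ () _)
    gen-mono (en {suc j} {r} {zero} {r′} j<1+s 1≤r r≤t _ _ r′≤t _ r≤r′) =
      subst (λ a → pos a C ≤ pos r′ C) (sym (+-assoc t (j * t) r))
        (lifted-before-bottom (≤-pred j<1+s) 1≤r r≤t r≤r′ r′≤t)
    gen-mono (en {suc j} {r} {suc j′} {r′} j<1+s 1≤r r≤t j′<1+s 1≤r′ r′≤t j′≤j r≤r′) =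
      subst₂ (λ a b → pos a C ≤ pos b C) (sym (+-assoc t (j * t) r)) (sym (+-assoc t (j′ * t) r′))
        (lift-gen (en (≤-pred j<1+s) 1≤r r≤t (≤-pred j′<1+s) 1≤r′ r′≤t (≤-pred j′≤j) r≤r′))
    gen-mono (saw {zero} _) = saw-bottom
    gen-mono (saw {suc i} 3+i≤1+s) =
      subst (λ b → pos (t + (2 + i) * t) C ≤ pos b C) (sym (+-assoc t (i * t) 2)) (lift-gen (saw (≤-pred 3+i≤1+s)))

    child-↭ : C ↭ range1 (suc s * t)
    child-↭ = begin
      (lift t U ++ 1 ∷ lift t V) ++ R  ↭⟨ ↭.++⁺ʳ R (↭.shift 1 (lift t U) (lift t V)) ⟩
      1 ∷ (lift t U ++ lift t V) ++ R  ↭⟨ prep 1 (↭.++-comm (lift t U ++ lift t V) R) ⟩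
      1 ∷ R ++ lift t U ++ lift t V    ≡⟨ cong (λ xs → 1 ∷ R ++ xs) (sym (map-++ (t +_) U V)) ⟩
      1 ∷ R ++ lift t (U ++ V)         ≡⟨ cong (λ xs → 1 ∷ R ++ lift t xs) front++back ⟩
      1 ∷ R ++ lift t π                ↭⟨ prep 1 (↭.++⁺ˡ R (↭.map⁺ (t +_) π↭)) ⟩
      1 ∷ R ++ lift t (range1 (s * t)) ≡⟨ range1-+ t (s * t) ⟨
      range1 (suc s * t)               ∎
      where open PermutationReasoning

    child-LinExt : LinExt (suc s) t C
    child-LinExt = linExt-by-pos child-↭ gen-mono

    restrict-child : restrict t C ≡ π
    restrict-child = begin
      restrict t ((lift t U ++ 1 ∷ lift t V) ++ R)
        ≡⟨ restrict-++ t (lift t U ++ 1 ∷ lift t V) R ⟩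
      restrict t (lift t U ++ 1 ∷ lift t V) ++ restrict t R
        ≡⟨ cong₂ _++_ (restrict-++ t (lift t U) (1 ∷ lift t V)) R-small ⟩
      (restrict t (lift t U) ++ restrict t (lift t V)) ++ []
        ≡⟨ ++-identityʳ _ ⟩
      restrict t (lift t U) ++ restrict t (lift t V)
        ≡⟨ cong₂ _++_ (restrict-lift t (positive ∈U⇒∈π)) (restrict-lift t (positive ∈V⇒∈π)) ⟩
      U ++ V
        ≡⟨ front++back ⟩
      π ∎
      where
      open ≡-Reasoning
      positive : ∀ {W} → (∀ {x} → x ∈ W → x ∈ π) → All (0 <_) W
      positive W⊆π = tabulate (proj₁ ∘ ∈π⁻ ∘ W⊆π)
      R-small : restrict t R ≡ []
      R-small = restrict-small t (tabulate λ x∈ →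
        let _ , i<t′ , x≡ = ∈-applyUpTo⁻ (2 +_) x∈ in subst (_≤ t) (sym x≡) (s≤s i<t′))

    label-child : label (suc s * t) C ≡ length V + t′
    label-child = begin
      suc s * t ∸ pos 1 C                          ≡⟨ cong₂ _∸_ (cong (t +_) (sym (length-split sp))) pos-one ⟩
      suc t′ + (length U + length V) ∸ suc (length U) ≡⟨ cong (_∸ length U) (+-comm t′ (length U + length V)) ⟩
      (length U + length V) + t′ ∸ length U        ≡⟨ cong (_∸ length U) (+-assoc (length U) (length V) t′) ⟩
      length U + (length V + t′) ∸ length U        ≡⟨ m+n∸m≡n (length U) (length V + t′) ⟩
      length V + t′                                ∎
      where open ≡-Reasoning

  module Characterisation {P : List ℕ} (P-child : IsChild s t π P) where
    private
      P-lin = proj₁ P-child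
      P↭ = proj₁ P-lin
      P-unique = Unique-↭range1 P↭
      ∈P⁺ = ∈-↭range1⁺ P↭

    ⪯⇒Before : ∀ {a b} → Saw (suc s) t a b → a ≢ b → Before P a b
    ⪯⇒Before = proj₂ P-lin _ _

    ¬small : ∀ {x} → x ∈ P → ¬ Small x → x ≡ 1 ⊎ t < x
    ¬small {x} x∈ ¬small-x with x ≤? t | proj₁ (∈-↭range1⁻ P↭ x∈)
    ... | no x≰t | _ = inj₂ (≰⇒> x≰t)
    ... | yes _ | s≤s {n = zero} _ = inj₁ refl
    ... | yes x≤t | s≤s {n = suc _} _ = contradiction (s≤s (s≤s z≤n) , x≤t) ¬small-x

    ⪯small : ∀ {x y} → x ∈ P → ¬ Small x → Small y → Saw (suc s) t x y
    ⪯small {x} {y} x∈ ¬small-x (2≤y , y≤t) with ¬small x∈ ¬small-x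
    ... | inj₁ refl = en z<s (s≤s z≤n) (s≤s z≤n) z<s 1≤y y≤t z≤n 1≤y ◅ ε
      where 1≤y = ≤-trans (s≤s z≤n) 2≤y
    ... | inj₂ t<x
      with j , r , j<1+s , 1≤r , r≤t , refl
             ← block-decomposition (suc s) t (≤-trans (s≤s z≤n) t<x) (proj₂ (∈-↭range1⁻ P↭ x∈))
      with j
    ... | zero = contradiction r≤t (<⇒≱ t<x)
    ... | suc j₀ = en j<1+s 1≤r r≤t (s≤s 1≤s) (s≤s z≤n) ≤-refl (s≤s z≤n) r≤t
                 ◅ subst (λ a → Saw (suc s) t a y) (+-comm t (t + 0))
                     (saw (s≤s 1≤s) ◅ small-⪯ (≤-refl , ≤-trans 2≤y y≤t) (2≤y , y≤t) 2≤y ◅ ε)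

    F R′ : List ℕ
    F = filter (¬? ∘ small?) P
    R′ = filter small? P

    P≡F++R′ : P ≡ F ++ R′
    P≡F++R′ = ++-filter-split small? P λ y-before-x small-y ¬small-x →
      Before-asym P-unique y-before-x
        (⪯⇒Before (⪯small (Before-∈ʳ y-before-x) ¬small-x small-y) (λ x≡y → ¬small-x (subst Small (sym x≡y) small-y)))

    small-increasing : ∀ {x y} → Before P x y → Small x → Small y → x < y
    small-increasing {x} {y} x-before-y small-x small-y with <-cmp x y
    ... | tri< x<y _ _ = x<y
    ... | tri≈ _ x≡y _ = contradiction x≡y (Before⇒≢ P-unique x-before-y)
    ... | tri> _ _ y<x = contradiction (⪯⇒Before (small-⪯ small-y small-x (<⇒≤ y<x) ◅ ε) (<⇒≢ y<x))
                                       (Before-asym P-unique x-before-y)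

    R′-increasing : AllPairs _<_ R′
    R′-increasing = Before⇒AllPairs R′ λ x-before-y →
      small-increasing (subst (λ xs → Before xs _ _) (sym P≡F++R′) (Before-++⁺ʳ F x-before-y))
        (proj₂ (∈-filter⁻ small? {xs = P} (Before-∈ˡ x-before-y)))
        (proj₂ (∈-filter⁻ small? {xs = P} (Before-∈ʳ x-before-y)))

    R′≡R : R′ ≡ applyUpTo (2 +_) t′
    R′≡R = increasing-interval 2 t′ R′-increasing
      (λ x∈ → let _ , 2≤x , x≤t = ∈-filter⁻ small? {xs = P} x∈ in 2≤x , s≤s x≤t)
      (λ 2≤x x<2+t′ → ∈-filter⁺ small? (∈P⁺ (≤-trans (s≤s z≤n) 2≤x) (≤-trans (≤-pred x<2+t′) (m≤m+n t (s * t))))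
                                      (2≤x , ≤-pred x<2+t′))

    F-big : ∀ {x} → x ∈ F → x ≢ 1 → t < x
    F-big x∈ x≢1 with x∈P , ¬small-x ← ∈-filter⁻ (¬? ∘ small?) {xs = P} x∈ with ¬small x∈P ¬small-x
    ... | inj₁ x≡1 = contradiction x≡1 x≢1
    ... | inj₂ t<x = t<x

    private
      F-split = ∈-∃++ (∈-filter⁺ (¬? ∘ small?) (∈P⁺ (s≤s z≤n) (s≤s z≤n)) λ { (s≤s () , _) })

    X Y : List ℕ
    X = proj₁ F-split
    Y = proj₁ (proj₂ F-split)

    P≡X1YR′ : P ≡ (X ++ 1 ∷ Y) ++ R′
    P≡X1YR′ = trans P≡F++R′ (cong (_++ R′) (proj₂ (proj₂ F-split)))

    private
      XY-unique : Unique (X ++ 1 ∷ (Y ++ R′))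
      XY-unique = subst Unique (trans P≡X1YR′ (++-assoc X (1 ∷ Y) R′)) P-unique
      ∈F : ∀ {x} → x ∈ X ++ 1 ∷ Y → x ∈ F
      ∈F = subst (_ ∈_) (sym (proj₂ (proj₂ F-split)))

    X-big : All (t <_) X
    X-big = tabulate λ x∈ → F-big (∈F (∈-++⁺ˡ x∈)) λ { refl → Unique-++⇒∉ˡ XY-unique x∈ }

    Y-big : All (t <_) Y
    Y-big = tabulate λ y∈ →
      F-big (∈F (∈-++⁺ʳ X (there y∈))) λ { refl → Unique-++⇒∉ʳ {X} XY-unique (∈-++⁺ˡ y∈) }

    -- t + 1 ⪯ 1, so t + 1 precedes 1 in P and is lifted from the front of π.
    t+1∈X : t + 1 ∈ X
    t+1∈X = Before-∈-prefix XY-unique (subst (λ xs → Before xs (t + 1) 1) (trans P≡X1YR′ (++-assoc X (1 ∷ Y) R′))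
      (⪯⇒Before t+1⪯1 (>⇒≢ (s≤s (m≤n+m 1 t′)))))
      where
      t+1⪯1 : Saw (suc s) t (t + 1) 1
      t+1⪯1 = subst (λ a → Saw (suc s) t a 1) (cong (_+ 1) (+-identityʳ t))
        (en {j = 1} {j' = 0} (s≤s 1≤s) (s≤s z≤n) (s≤s z≤n) z<s (s≤s z≤n) (s≤s z≤n) z≤n ≤-refl ◅ ε)

    split-of-child : Split π
    split-of-child = split (restrict t X) (restrict t Y) front++back 1∈front
      where
      front++back : restrict t X ++ restrict t Y ≡ π
      front++back = begin
        restrict t X ++ restrict t Y                      ≡⟨⟩ -- restrict t drops 1 by evaluation
        restrict t X ++ restrict t (1 ∷ Y)                ≡⟨ restrict-++ t X (1 ∷ Y) ⟨
        restrict t (X ++ 1 ∷ Y)                           ≡⟨ ++-identityʳ _ ⟨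
        restrict t (X ++ 1 ∷ Y) ++ []                     ≡⟨ cong (restrict t (X ++ 1 ∷ Y) ++_) R′-small ⟨
        restrict t (X ++ 1 ∷ Y) ++ restrict t R′          ≡⟨ restrict-++ t (X ++ 1 ∷ Y) R′ ⟨
        restrict t ((X ++ 1 ∷ Y) ++ R′)                   ≡⟨ cong (restrict t) P≡X1YR′ ⟨
        restrict t P                                      ≡⟨ proj₂ P-child ⟩
        π                                                 ∎
        where
        open ≡-Reasoning
        R′-small : restrict t R′ ≡ []
        R′-small = restrict-small t (tabulate (proj₂ ∘ proj₂ ∘ ∈-filter⁻ small? {xs = P}))
      1∈front : 1 ∈ restrict t X
      1∈front =
        subst (_∈ restrict t X) (m+n∸m≡n t 1) (∈-map⁺ (_∸ t) (∈-filter⁺ (t <?_) t+1∈X (m<m+n t z<s)))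

    P≡childAt : P ≡ childAt split-of-child
    P≡childAt = begin
      P
        ≡⟨ P≡X1YR′ ⟩
      (X ++ 1 ∷ Y) ++ R′
        ≡⟨ cong₂ (λ xs ys → (xs ++ 1 ∷ ys) ++ R′) (lift-restrict t X-big) (lift-restrict t Y-big) ⟨
      (lift t (restrict t X) ++ 1 ∷ lift t (restrict t Y)) ++ R′
        ≡⟨ cong ((lift t (restrict t X) ++ 1 ∷ lift t (restrict t Y)) ++_) R′≡R ⟩
      childAt split-of-child ∎
      where open ≡-Reasoning

  childAt-isChild : (sp : Split π) → IsChild s t π (childAt sp)
  childAt-isChild sp = Insertion.child-LinExt sp , Insertion.restrict-child sp

  child⇒childAt : ∀ {P} → IsChild s t π P → Σ (Split π) λ sp → P ≡ childAt sp
  child⇒childAt P-child = Characterisation.split-of-child P-child , Characterisation.P≡childAt P-child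

  label-bounds : ∀ {P} → IsChild s t π P →
                 t′ ≤ label (suc s * t) P × label (suc s * t) P ≤ label (s * t) π + t′
  label-bounds P-child with sp , refl ← child⇒childAt P-child rewrite Insertion.label-child sp =
    m≤n+m t′ _ , +-monoˡ-≤ t′ (length-back≤label sp)

  label-determines-child : ∀ {P₁ P₂} → IsChild s t π P₁ → IsChild s t π P₂ →
                           label (suc s * t) P₁ ≡ label (suc s * t) P₂ → P₁ ≡ P₂
  label-determines-child P₁-child P₂-child label≡
    with sp₁ , refl ← child⇒childAt P₁-child | sp₂ , refl ← child⇒childAt P₂-child =
    childAt-≡-by-length sp₁ sp₂ (+-cancelʳ-≡ t′ _ _
      (trans (sym (Insertion.label-child sp₁)) (trans label≡ (Insertion.label-child sp₂))))

  unique-child-with-label : ∀ k → t′ ≤ k → k ≤ label (s * t) π + t′ →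
    ∃ λ P → IsChild s t π P × label (suc s * t) P ≡ k ×
      (∀ P′ → IsChild s t π P′ → label (suc s * t) P′ ≡ k → P′ ≡ P)
  unique-child-with-label k t′≤k k≤ =
    childAt sp , childAt-isChild sp , label≡k ,
    λ P′ P′-child label′≡k →
      label-determines-child P′-child (childAt-isChild sp) (trans label′≡k (sym label≡k))
    where
    k∸t′≤label = m≤n+o⇒m∸n≤o k t′ (subst (k ≤_) (+-comm (label (s * t) π) t′) k≤)
    sp = proj₁ (split-with-back-length (k ∸ t′) k∸t′≤label)
    label≡k : label (suc s * t) (childAt sp) ≡ k
    label≡k = begin
      label (suc s * t) (childAt sp) ≡⟨ Insertion.label-child sp ⟩
      length (Split.back sp) + t′  ≡⟨ cong (_+ t′) (proj₂ (split-with-back-length (k ∸ t′) k∸t′≤label)) ⟩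
      k ∸ t′ + t′                  ≡⟨ m∸n+n≡m t′≤k ⟩
      k                            ∎
      where open ≡-Reasoning

theorem4p4 : (s t : ℕ) → 1 ≤ s → 1 ≤ t → (π : List ℕ) → LinExt s t π →
    (∀ k → t ∸ 1 ≤ k → k ≤ label (s * t) π + t ∸ 1 →
      ∃ λ π' → IsChild s t π π' × label (suc s * t) π' ≡ k ×
        (∀ π'' → IsChild s t π π'' → label (suc s * t) π'' ≡ k → π'' ≡ π'))
    × (∀ π' → IsChild s t π π' →
        (t ∸ 1 ≤ label (suc s * t) π') × (label (suc s * t) π' ≤ label (s * t) π + t ∸ 1))
theorem4p4 s zero _ () _ _
theorem4p4 s (suc t′) 1≤s _ π π-lin =
  (λ k t′≤k k≤ → unique-child-with-label k t′≤k (subst (k ≤_) top k≤)) ,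
  (λ P P-child → let t′≤label , label≤ = label-bounds P-child
                 in t′≤label , subst (label (suc s * t) P ≤_) (sym top) label≤)
  where
  open Children s t′ 1≤s π π-lin
  top : label (s * t) π + t ∸ 1 ≡ label (s * t) π + t′
  top = cong (_∸ 1) (+-suc (label (s * t) π) t′)
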